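{- Let $G$ be a graph and let $V_s,V_t\subseteq V(G)$ be feasible solutions of the spanning variant for the property "a graph is a tree" with $|V_s|=|V_t|\ge 2$. Then there is a reconfiguration sequence from $V_s$ to $V_t$ under the TJ rule if and only if $V_s$ and $V_t$ are contained in the same connected component of $G$.
   Context: Graphs are finite, simple and undirected. In the spanning variant for property $\Pi$ on a graph $G$, a feasible solution is a vertex subset $V'\subseteq V(G)$ such that $G[V']$ contains a spanning subgraph satisfying $\Pi$ (for $\Pi$ = "is a tree", this means $G[V']$ is connected). Under the token jumping (TJ) rule, two feasible solutions $X,Y$ are adjacent if $|X\setminus Y|=|Y\setminus X|=1$. A reconfiguration sequence is a sequence of feasible solutions in which consecutive ones are adjacent. -}

module Defs where

open import Data.Nat using (ℕ)
open import Data.Fin using (Fin)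
open import Data.Fin.Subset using (Subset; _∈_; _─_; ∣_∣; _∪_; ⊤)
open import Data.Product using (∃; _×_)
open import Relation.Binary.PropositionalEquality using (_≡_)
open import Relation.Nullary using (¬_)

record Graph : Set₁ where
  field
    n     : ℕ
    Adj   : Fin n → Fin n → Set
    sym   : ∀ {u v} → Adj u v → Adj v u
    irrefl : ∀ {u} → ¬ Adj u u

open Graph public

data WalkIn (G : Graph) (S : Subset (n G)) : Fin (n G) → Fin (n G) → Set where
  stop : ∀ {u} → u ∈ S → WalkIn G S u u
  step : ∀ {u w v} → u ∈ S → Adj G u w → WalkIn G S w v → WalkIn G S u v

InducedConnected : (G : Graph) → Subset (n G) → Set
InducedConnected G S = ∀ {u v} → u ∈ S → v ∈ S → WalkIn G S u v

-- Feasible solution of the spanning variant for "is a tree":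
-- G[S] has a spanning tree, i.e. G[S] is connected.
FeasibleTree : (G : Graph) → Subset (n G) → Set
FeasibleTree = InducedConnected

Reachable : (G : Graph) → Fin (n G) → Fin (n G) → Set
Reachable G = WalkIn G ⊤

TJAdj : (G : Graph) → Subset (n G) → Subset (n G) → Set
TJAdj G X Y = (∣ X ─ Y ∣ ≡ 1) × (∣ Y ─ X ∣ ≡ 1)

data ReconfSeq (G : Graph) : Subset (n G) → Subset (n G) → Set where
  done : ∀ {X} → FeasibleTree G X → ReconfSeq G X X
  step : ∀ {X Y Z} → FeasibleTree G X → TJAdj G X Y → ReconfSeq G Y Z → ReconfSeq G X Z

SameComponent : (G : Graph) → Subset (n G) → Subset (n G) → Set
SameComponent G X Y = ∃ λ w → ∀ {v} → v ∈ X ∪ Y → Reachable G w v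

-- Forward: consecutive solutions X, Y with |X| ≥ 2 share |X| − 1 ≥ 1 vertices, so their
-- connected subgraphs lie in one component of G.
-- Backward: if Y is connected and P ⊊ Y is connected and nonempty, then some x ∈ Y ∖ P is
-- not a cut vertex of G[Y] (grow P along boundary edges until only one vertex of Y is left
-- outside). Hence a vertex z adjacent to a connected X can be swapped in for some vertex of
-- X ∖ P while keeping X connected and P in place. Swapping along a walk brings a token onto
-- a vertex t of Vt; then growing a connected P ⊆ X ∩ Vt from t, one boundary vertex of Vt
-- at a time, ends with X = Vt.
module Submission where

open import Defs
open import Data.Nat using (_≤_)
open import Data.Fin.Subset using (∣_∣; Subset)
open import Data.Product using (_×_)
open import Relation.Binary.PropositionalEquality using (_≡_)
open import Function.Bundles using (_⇔_)

open import Data.Nat using (ℕ; zero; suc; _+_; _<_; s≤s; z≤n)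
open import Data.Nat.Properties using (+-suc; +-comm; ≤-pred; ≤-trans; <-≤-trans; n<1+n; <-irrefl)
open import Data.Fin using (Fin; zero; suc; _≟_)
open import Data.Fin.Subset
  using (_∈_; _∉_; _⊆_; _∩_; _∪_; _─_; _-_; ⁅_⁆; ⊤; ⊥; inside; outside; Nonempty)
open import Data.Fin.Subset.Properties
open import Data.Vec using (_∷_; []; here; there)
open import Data.Product using (∃; _,_; proj₁; proj₂)
open import Data.Sum using (_⊎_; inj₁; inj₂; [_,_])
open import Data.Empty using (⊥-elim)
open import Function using (_∘_)
open import Function.Bundles using (mk⇔)
open import Relation.Nullary using (yes; no; contradiction)
open import Relation.Binary.PropositionalEquality
  using (_≢_; refl; trans; cong; cong₂; subst; module ≡-Reasoning)
  renaming (sym to ≡-sym)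

private
  variable
    k : ℕ
    x y : Fin k
    p q : Subset k

x∈p─q⁻ : x ∈ p ─ q → x ∈ p × x ∉ q
x∈p─q⁻ {p = inside ∷ _} {outside ∷ _} here = here , λ ()
x∈p─q⁻ {x = zero} {outside ∷ _} {inside ∷ _} ()
x∈p─q⁻ {x = zero} {outside ∷ _} {outside ∷ _} ()
x∈p─q⁻ {p = _ ∷ _} {_ ∷ _} (there x∈p─q) =
  let (x∈p , x∉q) = x∈p─q⁻ x∈p─q in there x∈p , x∉q ∘ drop-there

x∈p-y⁻ : x ∈ p - y → x ∈ p × x ≢ y
x∈p-y⁻ x∈p-y = let (x∈p , x∉⁅y⁆) = x∈p─q⁻ x∈p-y in x∈p , x∉⁅y⁆⇒x≢y x∉⁅y⁆

x∈p∪⁅y⁆⁻ : x ∈ p ∪ ⁅ y ⁆ → x ∈ p ⊎ x ≡ y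
x∈p∪⁅y⁆⁻ {p = p} {y = y} x∈p∪⁅y⁆ with x∈p∪q⁻ p ⁅ y ⁆ x∈p∪⁅y⁆
... | inj₁ x∈p = inj₁ x∈p
... | inj₂ x∈⁅y⁆ = inj₂ (x∈⁅y⁆⇒x≡y y x∈⁅y⁆)

y∈p∪⁅y⁆ : y ∈ p ∪ ⁅ y ⁆
y∈p∪⁅y⁆ {y = y} = x∈p∪q⁺ (inj₂ (x∈⁅x⁆ y))

⁅x⁆⊆p : x ∈ p → ⁅ x ⁆ ⊆ p
⁅x⁆⊆p {x = x} x∈p y∈⁅x⁆ = subst (_∈ _) (≡-sym (x∈⁅y⁆⇒x≡y x y∈⁅x⁆)) x∈p

p∪⁅x⁆⊆q : p ⊆ q → x ∈ q → p ∪ ⁅ x ⁆ ⊆ q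
p∪⁅x⁆⊆q {p = p} {x = x} p⊆q x∈q = [ p⊆q , ⁅x⁆⊆p x∈q ] ∘ x∈p∪q⁻ p ⁅ x ⁆

∣p∣≡∣p∩q∣+∣p─q∣ : (p q : Subset k) → ∣ p ∣ ≡ ∣ p ∩ q ∣ + ∣ p ─ q ∣
∣p∣≡∣p∩q∣+∣p─q∣ [] [] = refl
∣p∣≡∣p∩q∣+∣p─q∣ (inside ∷ p) (inside ∷ q) = cong suc (∣p∣≡∣p∩q∣+∣p─q∣ p q)
∣p∣≡∣p∩q∣+∣p─q∣ (inside ∷ p) (outside ∷ q) =
  trans (cong suc (∣p∣≡∣p∩q∣+∣p─q∣ p q)) (≡-sym (+-suc _ _))
∣p∣≡∣p∩q∣+∣p─q∣ (outside ∷ p) (inside ∷ q) = ∣p∣≡∣p∩q∣+∣p─q∣ p q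
∣p∣≡∣p∩q∣+∣p─q∣ (outside ∷ p) (outside ∷ q) = ∣p∣≡∣p∩q∣+∣p─q∣ p q

∣p∣<∣q∣⇒∃q∖p : (p q : Subset k) → ∣ p ∣ < ∣ q ∣ → ∃ λ x → x ∈ q × x ∉ p
∣p∣<∣q∣⇒∃q∖p (outside ∷ p) (inside ∷ q) _ = zero , here , λ ()
∣p∣<∣q∣⇒∃q∖p (inside ∷ p) (inside ∷ q) (s≤s ∣p∣<∣q∣) =
  let (x , x∈q , x∉p) = ∣p∣<∣q∣⇒∃q∖p p q ∣p∣<∣q∣ in suc x , there x∈q , x∉p ∘ drop-there
∣p∣<∣q∣⇒∃q∖p (s ∷ p) (outside ∷ q) ∣s∷p∣<∣q∣ =
  let (x , x∈q , x∉p) = ∣p∣<∣q∣⇒∃q∖p p q (<-≤-trans (s≤s (∣p∣≤∣x∷p∣ s p)) ∣s∷p∣<∣q∣)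
  in suc x , there x∈q , x∉p ∘ drop-there

0<∣p∣⇒Nonempty : (p : Subset k) → 0 < ∣ p ∣ → Nonempty p
0<∣p∣⇒Nonempty {k} p 0<∣p∣ =
  let (x , x∈p , _) = ∣p∣<∣q∣⇒∃q∖p ⊥ p (subst (_< ∣ p ∣) (≡-sym (∣⊥∣≡0 k)) 0<∣p∣) in x , x∈p

p⊆q⇒∣p∣≡∣q∣⇒p≡q : p ⊆ q → ∣ p ∣ ≡ ∣ q ∣ → p ≡ q
p⊆q⇒∣p∣≡∣q∣⇒p≡q {p = p} {q = q} p⊆q ∣p∣≡∣q∣ = ⊆-antisym p⊆q q⊆p
  where
  q⊆p : q ⊆ p
  q⊆p {x} x∈q with x ∈? p
  ... | yes x∈p = x∈p
  ... | no x∉p = ⊥-elim (<-irrefl ∣p∣≡∣q∣ (p⊂q⇒∣p∣<∣q∣ (p⊆q , x , x∈q , x∉p)))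

∣p─q∪⁅x⁆∣<∣p─q∣ : x ∈ p ─ q → ∣ p ─ (q ∪ ⁅ x ⁆) ∣ < ∣ p ─ q ∣
∣p─q∪⁅x⁆∣<∣p─q∣ {x = x} {p = p} {q = q} x∈p─q =
  subst (λ r → ∣ r ∣ < ∣ p ─ q ∣) (p─q─r≡p─q∪r p q ⁅ x ⁆) (x∈p⇒∣p-x∣<∣p∣ x∈p─q)

x∈p∧unique⇒∣p∣≡1 : x ∈ p → (∀ {y} → y ∈ p → y ≡ x) → ∣ p ∣ ≡ 1
x∈p∧unique⇒∣p∣≡1 {x = x} {p = p} x∈p unique = trans (cong ∣_∣ p≡⁅x⁆) (∣⁅x⁆∣≡1 x)
  where
  p≡⁅x⁆ : p ≡ ⁅ x ⁆
  p≡⁅x⁆ = ⊆-antisym (λ y∈p → subst (_∈ ⁅ x ⁆) (≡-sym (unique y∈p)) (x∈⁅x⁆ x)) (⁅x⁆⊆p x∈p)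

module TokenJumping (G : Graph) where
  private
    V = Fin (n G)
    S = Subset (n G)

  source∈ : ∀ {A : S} {u v} → WalkIn G A u v → u ∈ A
  source∈ (stop u∈A) = u∈A
  source∈ (step u∈A _ _) = u∈A

  _++_ : ∀ {A : S} {u v w} → WalkIn G A u v → WalkIn G A v w → WalkIn G A u w
  stop _ ++ walk = walk
  step u∈A adj rest ++ walk = step u∈A adj (rest ++ walk)

  reverse : ∀ {A : S} {u v} → WalkIn G A u v → WalkIn G A v u
  reverse (stop u∈A) = stop u∈A
  reverse (step u∈A adj rest) = reverse rest ++ step (source∈ rest) (Graph.sym G adj) (stop u∈A)

  walk-mono : ∀ {A B : S} {u v} → A ⊆ B → WalkIn G A u v → WalkIn G B u v
  walk-mono A⊆B (stop u∈A) = stop (A⊆B u∈A)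
  walk-mono A⊆B (step u∈A adj rest) = step (A⊆B u∈A) adj (walk-mono A⊆B rest)

  ⁅x⁆-connected : (x : V) → InducedConnected G ⁅ x ⁆
  ⁅x⁆-connected x u∈ v∈ with x∈⁅y⁆⇒x≡y x u∈ | x∈⁅y⁆⇒x≡y x v∈
  ... | refl | refl = stop (x∈⁅x⁆ x)

  p∪⁅z⁆-connected : ∀ {P : S} {a z} → InducedConnected G P → a ∈ P → Adj G a z →
                    InducedConnected G (P ∪ ⁅ z ⁆)
  p∪⁅z⁆-connected {P} {a} {z} P-connected a∈P adj u∈ v∈ = reverse (from-a u∈) ++ from-a v∈
    where
    from-a : ∀ {v} → v ∈ P ∪ ⁅ z ⁆ → WalkIn G (P ∪ ⁅ z ⁆) a v
    from-a v∈ with x∈p∪⁅y⁆⁻ v∈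
    ... | inj₁ v∈P = walk-mono (p⊆p∪q ⁅ z ⁆) (P-connected a∈P v∈P)
    ... | inj₂ refl = step (p⊆p∪q ⁅ z ⁆ a∈P) adj (stop y∈p∪⁅y⁆)

  data ExitEdge (A P : S) : Set where
    exit : ∀ {a z} → a ∈ P → Adj G a z → z ∈ A → z ∉ P → ExitEdge A P

  exit-edge : ∀ {A P : S} {u v} → WalkIn G A u v → u ∈ P → v ∉ P → ExitEdge A P
  exit-edge (stop _) u∈P v∉P = contradiction u∈P v∉P
  exit-edge {P = P} (step {w = w} _ adj rest) u∈P v∉P with w ∈? P
  ... | yes w∈P = exit-edge rest w∈P v∉P
  ... | no w∉P = exit u∈P adj (source∈ rest) w∉P

  non-cut-vertex : (f : ℕ) {Y P : S} {p y : V} →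
                   InducedConnected G Y → InducedConnected G P → P ⊆ Y → p ∈ P →
                   y ∈ Y → y ∉ P → ∣ Y ─ P ∣ < f →
                   ∃ λ x → x ∈ Y × x ∉ P × InducedConnected G (Y - x)
  non-cut-vertex (suc f) {Y} {P} Y-connected P-connected P⊆Y p∈P y∈Y y∉P ∣Y─P∣<1+f
    with exit-edge (Y-connected (P⊆Y p∈P) y∈Y) p∈P y∉P
  ... | exit {z = z} a∈P adj z∈Y z∉P with nonempty? (Y ─ (P ∪ ⁅ z ⁆))
  ... | yes (y′ , y′∈Y─P′) =
    let (y′∈Y , y′∉P′) = x∈p─q⁻ y′∈Y─P′
        (x , x∈Y , x∉P′ , Y-x-connected) =
          non-cut-vertex f Y-connected (p∪⁅z⁆-connected P-connected a∈P adj) (p∪⁅x⁆⊆q P⊆Y z∈Y)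
            (p⊆p∪q ⁅ z ⁆ p∈P) y′∈Y y′∉P′
            (<-≤-trans (∣p─q∪⁅x⁆∣<∣p─q∣ (x∈p∧x∉q⇒x∈p─q z∈Y z∉P)) (≤-pred ∣Y─P∣<1+f))
    in x , x∈Y , x∉P′ ∘ p⊆p∪q ⁅ z ⁆ , Y-x-connected
  ... | no nothing-beyond = z , z∈Y , z∉P , subst (InducedConnected G) P≡Y-z P-connected
    where
    P≡Y-z : P ≡ Y - z
    P≡Y-z = ⊆-antisym (λ v∈P → x∈p∧x≢y⇒x∈p-y (P⊆Y v∈P) λ { refl → z∉P v∈P }) Y-z⊆P
      where
      Y-z⊆P : Y - z ⊆ P
      Y-z⊆P {v} v∈Y-z with v ∈? P
      ... | yes v∈P = v∈P
      ... | no v∉P = let (v∈Y , v≢z) = x∈p-y⁻ v∈Y-z in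
        ⊥-elim (nothing-beyond (v , x∈p∧x∉q⇒x∈p─q v∈Y ([ v∉P , v≢z ] ∘ x∈p∪⁅y⁆⁻)))

  exchange-TJAdj : ∀ {X : S} {x z} → x ∈ X → z ∉ X → TJAdj G X (X ∪ ⁅ z ⁆ - x)
  exchange-TJAdj {X} {x} {z} x∈X z∉X =
    x∈p∧unique⇒∣p∣≡1 (x∈p∧x∉q⇒x∈p─q x∈X (λ x∈X′ → proj₂ (x∈p-y⁻ x∈X′) refl)) only-x ,
    x∈p∧unique⇒∣p∣≡1 (x∈p∧x∉q⇒x∈p─q z∈X′ z∉X) only-z
    where
    z∈X′ : z ∈ X ∪ ⁅ z ⁆ - x
    z∈X′ = x∈p∧x≢y⇒x∈p-y y∈p∪⁅y⁆ λ { refl → z∉X x∈X }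
    only-x : ∀ {v} → v ∈ X ─ (X ∪ ⁅ z ⁆ - x) → v ≡ x
    only-x {v} v∈ with v ≟ x
    ... | yes v≡x = v≡x
    ... | no v≢x = let (v∈X , v∉X′) = x∈p─q⁻ v∈ in
      contradiction (x∈p∧x≢y⇒x∈p-y (p⊆p∪q ⁅ z ⁆ v∈X) v≢x) v∉X′
    only-z : ∀ {v} → v ∈ (X ∪ ⁅ z ⁆ - x) ─ X → v ≡ z
    only-z v∈ with x∈p─q⁻ v∈
    ... | v∈X′ , v∉X with x∈p∪⁅y⁆⁻ (proj₁ (x∈p-y⁻ v∈X′))
    ... | inj₁ v∈X = contradiction v∈X v∉X
    ... | inj₂ v≡z = v≡z

  TJAdj⇒∣∣≡ : ∀ {X Y : S} → TJAdj G X Y → ∣ X ∣ ≡ ∣ Y ∣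
  TJAdj⇒∣∣≡ {X} {Y} (∣X─Y∣≡1 , ∣Y─X∣≡1) = begin
    ∣ X ∣                  ≡⟨ ∣p∣≡∣p∩q∣+∣p─q∣ X Y ⟩
    ∣ X ∩ Y ∣ + ∣ X ─ Y ∣  ≡⟨ cong₂ _+_ (cong ∣_∣ (∩-comm X Y)) (trans ∣X─Y∣≡1 (≡-sym ∣Y─X∣≡1)) ⟩
    ∣ Y ∩ X ∣ + ∣ Y ─ X ∣  ≡⟨ ≡-sym (∣p∣≡∣p∩q∣+∣p─q∣ Y X) ⟩
    ∣ Y ∣                  ∎
    where open ≡-Reasoning

  TJAdj⇒shared-vertex : ∀ {X Y : S} → 2 ≤ ∣ X ∣ → TJAdj G X Y → Nonempty (X ∩ Y)
  TJAdj⇒shared-vertex {X} {Y} 2≤∣X∣ (∣X─Y∣≡1 , _) = 0<∣p∣⇒Nonempty (X ∩ Y) (≤-pred 2≤1+∣X∩Y∣)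
    where
    2≤1+∣X∩Y∣ : 2 ≤ suc ∣ X ∩ Y ∣
    2≤1+∣X∩Y∣ = subst (2 ≤_)
      (trans (∣p∣≡∣p∩q∣+∣p─q∣ X Y) (trans (cong (∣ X ∩ Y ∣ +_) ∣X─Y∣≡1) (+-comm _ 1))) 2≤∣X∣

  _◅◅_ : ∀ {X Y Z : S} → ReconfSeq G X Y → ReconfSeq G Y Z → ReconfSeq G X Z
  done _ ◅◅ rest = rest
  step X-feasible tj seq ◅◅ rest = step X-feasible tj (seq ◅◅ rest)

  target-feasible : ∀ {X Y : S} → ReconfSeq G X Y → FeasibleTree G Y
  target-feasible (done Y-feasible) = Y-feasible
  target-feasible (step _ _ seq) = target-feasible seq

  ReconfSeq⇒∣∣≡ : ∀ {X Y : S} → ReconfSeq G X Y → ∣ X ∣ ≡ ∣ Y ∣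
  ReconfSeq⇒∣∣≡ (done _) = refl
  ReconfSeq⇒∣∣≡ {X} (step {Y = Y} _ tj seq) = trans (TJAdj⇒∣∣≡ {X} {Y} tj) (ReconfSeq⇒∣∣≡ seq)

  ReconfSeq⇒Reachable : ∀ {X Z : S} {u v} → ReconfSeq G X Z → 2 ≤ ∣ X ∣ → u ∈ X → v ∈ Z →
                        Reachable G u v
  ReconfSeq⇒Reachable (done X-connected) _ u∈X v∈X = walk-mono ⊆⊤ (X-connected u∈X v∈X)
  ReconfSeq⇒Reachable {X} (step {Y = Y} X-connected tj seq) 2≤∣X∣ u∈X v∈Z =
    let (s , s∈X∩Y) = TJAdj⇒shared-vertex {X} {Y} 2≤∣X∣ tj
        (s∈X , s∈Y) = x∈p∩q⁻ X Y s∈X∩Y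
    in walk-mono ⊆⊤ (X-connected u∈X s∈X)
       ++ ReconfSeq⇒Reachable seq (subst (2 ≤_) (TJAdj⇒∣∣≡ {X} {Y} tj) 2≤∣X∣) s∈Y v∈Z

  absorb : ∀ {X P : S} {a z y} → InducedConnected G X → InducedConnected G P → P ⊆ X →
           a ∈ P → Adj G a z → y ∈ X → y ∉ P →
           ∃ λ X′ → ReconfSeq G X X′ × P ∪ ⁅ z ⁆ ⊆ X′
  absorb {X} {P} {z = z} {y} X-connected P-connected P⊆X a∈P adj y∈X y∉P with z ∈? X
  ... | yes z∈X = X , done X-connected , p∪⁅x⁆⊆q P⊆X z∈X
  ... | no z∉X
    with non-cut-vertex (suc ∣ X ∪ ⁅ z ⁆ ─ P ∪ ⁅ z ⁆ ∣)
           (p∪⁅z⁆-connected X-connected (P⊆X a∈P) adj) (p∪⁅z⁆-connected P-connected a∈P adj)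
           (p∪⁅x⁆⊆q (p⊆p∪q ⁅ z ⁆ ∘ P⊆X) y∈p∪⁅y⁆) y∈p∪⁅y⁆ (p⊆p∪q ⁅ z ⁆ y∈X) y∉P∪⁅z⁆ (n<1+n _)
    where
    y∉P∪⁅z⁆ : y ∉ P ∪ ⁅ z ⁆
    y∉P∪⁅z⁆ = [ y∉P , (λ { refl → z∉X y∈X }) ] ∘ x∈p∪⁅y⁆⁻
  ... | x , x∈X∪⁅z⁆ , x∉P∪⁅z⁆ , X′-connected =
    X ∪ ⁅ z ⁆ - x , step X-connected (exchange-TJAdj x∈X z∉X) (done X′-connected) ,
    λ v∈ → x∈p∧x≢y⇒x∈p-y (p∪⁅x⁆⊆q (p⊆p∪q ⁅ z ⁆ ∘ P⊆X) y∈p∪⁅y⁆ v∈) λ { refl → x∉P∪⁅z⁆ v∈ }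
    where
    x∈X : x ∈ X
    x∈X = [ (λ x∈X → x∈X) , (λ { refl → contradiction y∈p∪⁅y⁆ x∉P∪⁅z⁆ }) ] (x∈p∪⁅y⁆⁻ x∈X∪⁅z⁆)

  approach : ∀ {X : S} {a t} → Reachable G a t → InducedConnected G X → 2 ≤ ∣ X ∣ → a ∈ X →
             ∃ λ X′ → ReconfSeq G X X′ × t ∈ X′
  approach (stop _) X-connected _ a∈X = _ , done X-connected , a∈X
  approach {X} {a} (step _ adj walk) X-connected 2≤∣X∣ a∈X =
    let (y , y∈X , y∉⁅a⁆) = ∣p∣<∣q∣⇒∃q∖p ⁅ a ⁆ X (subst (_< ∣ X ∣) (≡-sym (∣⁅x⁆∣≡1 a)) 2≤∣X∣)
        (_ , seq , ⁅a⁆∪⁅w⁆⊆X′) =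
          absorb X-connected (⁅x⁆-connected a) (⁅x⁆⊆p a∈X) (x∈⁅x⁆ a) adj y∈X y∉⁅a⁆
        (X″ , seq′ , t∈X″) = approach walk (target-feasible seq)
          (subst (2 ≤_) (ReconfSeq⇒∣∣≡ seq) 2≤∣X∣) (⁅a⁆∪⁅w⁆⊆X′ y∈p∪⁅y⁆)
    in X″ , seq ◅◅ seq′ , t∈X″

  module _ {Vt : S} (Vt-connected : InducedConnected G Vt) where

    grow : (f : ℕ) {X P : S} {p : V} → InducedConnected G X → ∣ X ∣ ≡ ∣ Vt ∣ →
           InducedConnected G P → p ∈ P → P ⊆ X → P ⊆ Vt → ∣ Vt ─ P ∣ < f → ReconfSeq G X Vt
    grow (suc f) {X} {P} X-connected ∣X∣≡∣Vt∣ P-connected p∈P P⊆X P⊆Vt ∣Vt─P∣<1+f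
      with nonempty? (Vt ─ P)
    ... | no nothing-beyond = subst (ReconfSeq G X) (≡-sym Vt≡X) (done X-connected)
      where
      Vt⊆X : Vt ⊆ X
      Vt⊆X {v} v∈Vt with v ∈? P
      ... | yes v∈P = P⊆X v∈P
      ... | no v∉P = ⊥-elim (nothing-beyond (v , x∈p∧x∉q⇒x∈p─q v∈Vt v∉P))
      Vt≡X : Vt ≡ X
      Vt≡X = p⊆q⇒∣p∣≡∣q∣⇒p≡q Vt⊆X (≡-sym ∣X∣≡∣Vt∣)
    ... | yes (y , y∈Vt─P) with x∈p─q⁻ y∈Vt─P
    ... | y∈Vt , y∉P with exit-edge (Vt-connected (P⊆Vt p∈P) y∈Vt) p∈P y∉P
    ... | exit {z = z} a∈P adj z∈Vt z∉P =
      let (x , x∈X , x∉P) = ∣p∣<∣q∣⇒∃q∖p P X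
            (subst (∣ P ∣ <_) (≡-sym ∣X∣≡∣Vt∣) (p⊂q⇒∣p∣<∣q∣ (P⊆Vt , y , y∈Vt , y∉P)))
          (_ , seq , P∪⁅z⁆⊆X′) = absorb X-connected P-connected P⊆X a∈P adj x∈X x∉P
      in seq ◅◅ grow f (target-feasible seq) (trans (≡-sym (ReconfSeq⇒∣∣≡ seq)) ∣X∣≡∣Vt∣)
                   (p∪⁅z⁆-connected P-connected a∈P adj) (p⊆p∪q ⁅ z ⁆ p∈P)
                   P∪⁅z⁆⊆X′ (p∪⁅x⁆⊆q P⊆Vt z∈Vt)
                   (<-≤-trans (∣p─q∪⁅x⁆∣<∣p─q∣ z∈Vt─P) (≤-pred ∣Vt─P∣<1+f))
      where
      z∈Vt─P : z ∈ Vt ─ P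
      z∈Vt─P = x∈p∧x∉q⇒x∈p─q z∈Vt z∉P

    converge : ∀ {X : S} {t} → InducedConnected G X → ∣ X ∣ ≡ ∣ Vt ∣ → t ∈ X → t ∈ Vt →
               ReconfSeq G X Vt
    converge {t = t} X-connected ∣X∣≡∣Vt∣ t∈X t∈Vt =
      grow (suc ∣ Vt ─ ⁅ t ⁆ ∣) X-connected ∣X∣≡∣Vt∣ (⁅x⁆-connected t) (x∈⁅x⁆ t)
        (⁅x⁆⊆p t∈X) (⁅x⁆⊆p t∈Vt) (n<1+n _)

  ReconfSeq⇒SameComponent : ∀ {X Y : S} → InducedConnected G X → 2 ≤ ∣ X ∣ → ReconfSeq G X Y →
                            SameComponent G X Y
  ReconfSeq⇒SameComponent {X} {Y} X-connected 2≤∣X∣ seq =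
    let (s , s∈X) = 0<∣p∣⇒Nonempty X (≤-trans (s≤s z≤n) 2≤∣X∣)
    in s , λ v∈ → [ walk-mono ⊆⊤ ∘ X-connected s∈X , ReconfSeq⇒Reachable seq 2≤∣X∣ s∈X ]
                    (x∈p∪q⁻ X Y v∈)

  SameComponent⇒ReconfSeq : ∀ {X Y : S} → InducedConnected G X → InducedConnected G Y →
                            ∣ X ∣ ≡ ∣ Y ∣ → 2 ≤ ∣ X ∣ → SameComponent G X Y → ReconfSeq G X Y
  SameComponent⇒ReconfSeq {X} {Y} X-connected Y-connected ∣X∣≡∣Y∣ 2≤∣X∣ (_ , reachable) =
    let 0<∣X∣ = ≤-trans (s≤s z≤n) 2≤∣X∣
        (s , s∈X) = 0<∣p∣⇒Nonempty X 0<∣X∣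
        (t , t∈Y) = 0<∣p∣⇒Nonempty Y (subst (0 <_) ∣X∣≡∣Y∣ 0<∣X∣)
        s⇝t = reverse (reachable (x∈p∪q⁺ (inj₁ s∈X))) ++ reachable (x∈p∪q⁺ (inj₂ t∈Y))
        (_ , seq , t∈Z) = approach s⇝t X-connected 2≤∣X∣ s∈X
    in seq ◅◅ converge Y-connected (target-feasible seq) (trans (≡-sym (ReconfSeq⇒∣∣≡ seq)) ∣X∣≡∣Y∣)
                 t∈Z t∈Y

lemma2 : (G : Graph) (Vs Vt : Subset (n G)) →
    FeasibleTree G Vs → FeasibleTree G Vt →
    ∣ Vs ∣ ≡ ∣ Vt ∣ → 2 ≤ ∣ Vs ∣ →
    ReconfSeq G Vs Vt ⇔ SameComponent G Vs Vt
lemma2 G Vs Vt Vs-connected Vt-connected ∣Vs∣≡∣Vt∣ 2≤∣Vs∣ =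
  mk⇔ (ReconfSeq⇒SameComponent Vs-connected 2≤∣Vs∣)
      (SameComponent⇒ReconfSeq Vs-connected Vt-connected ∣Vs∣≡∣Vt∣ 2≤∣Vs∣)
  where open TokenJumping G
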